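{- Let $m\in\mathbb{N}$, $N=2^{m+1}$, and let $I$ be the set of $2m$ rectangles $V_1,\dots,V_m,H_1,\dots,H_m$ defined below. Given a $k$-stage packing of a set of long rectangles $I'\subseteq I$ in the $N\times N$ knapsack, there exists a container packing of $I'$ which uses $k$ containers and in which the rectangles are guillotine separable.
   Context: For $j\in[m]$, $V_j$ is a vertical rectangle of height $N-(2^j-1)$ and width $2^{j-1}$, and $H_j$ is a horizontal rectangle of height $2^{j-1}$ and width $N-(2^{j-1}-1)$. A rectangle is long if its width or height exceeds $N/2$. Packings place rectangles by translation as pairwise disjoint open rectangles in $[0,N]^2$. A packing in a rectangle $R$ is guillotine separable if it has at most one item or some horizontal/vertical segment spanning $R$ meets no item interior and splits $R$ into two rectangles whose packings are guillotine separable. A $k$-stage packing is one that can be separated by a guillotine cutting process organized in $k$ stages: in each stage every current piece is cut by end-to-end cuts all of the same orientation (vertical or horizontal), the orientation alternating between consecutive stages, so that after $k$ stages each piece contains at most one item (plus a final trimming cut separating the item from waste). A container packing places all items into non-overlapping axis-aligned rectangles (containers), each of which is large (one item), horizontal (items stacked on top of each other), vertical (items side by side), or area (a container of size $a\times b$ containing only items with width at most $\varepsilon a$ and height at most $\varepsilon b$).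
   Formalization: The given k-stage packing has rational item positions and rational cut coordinates, and the accuracy parameter ε ranges over the positive rationals. -}

module Defs where

open import Data.Nat as ℕ using (ℕ; zero; suc; _∸_; _^_)
open import Data.Integer using (+_)
open import Data.Rational using (ℚ; _≤_; _<_; _+_; _*_; _/_; 0ℚ)
open import Data.Fin using (Fin; toℕ)
open import Data.Bool using (Bool; true)
open import Data.List using (List; []; _∷_)
open import Data.List.Membership.Propositional using (_∈_)
open import Data.Product using (_×_; _,_; Σ; ∃)
open import Data.Sum using (_⊎_)
open import Relation.Binary.PropositionalEquality using (_≡_; _≢_)

toℚ : ℕ → ℚ
toℚ n = + n / 1

-- The instance I = {V_1..V_m, H_1..H_m}, N = 2^(m+1).
-- The index i : Fin m stands for j = i + 1 ∈ [m].

sideN : ℕ → ℕ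
sideN m = 2 ^ suc m

data Item (m : ℕ) : Set where
  V : Fin m → Item m
  H : Fin m → Item m

-- width and height (natural numbers)
-- V_j : width 2^(j-1), height N - (2^j - 1)
-- H_j : width N - (2^(j-1) - 1), height 2^(j-1)
widthℕ : ∀ {m} → Item m → ℕ
widthℕ {m} (V i) = 2 ^ toℕ i
widthℕ {m} (H i) = sideN m ∸ (2 ^ toℕ i ∸ 1)

heightℕ : ∀ {m} → Item m → ℕ
heightℕ {m} (V i) = sideN m ∸ (2 ^ suc (toℕ i) ∸ 1)
heightℕ {m} (H i) = 2 ^ toℕ i

Long : ∀ {m} → Item m → Set
Long {m} it = (sideN m ℕ.< 2 ℕ.* widthℕ it) ⊎ (sideN m ℕ.< 2 ℕ.* heightℕ it)

SubInstance : ℕ → Set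
SubInstance m = Item m → Bool

_∈'_ : ∀ {m} → Item m → SubInstance m → Set
it ∈' I' = I' it ≡ true

-- Geometry.  Axis-parallel boxes [x , x + w] × [y , y + h] with rational
-- coordinates.

record Box : Set where
  constructor box
  field
    bx bw by bh : ℚ
open Box public

InteriorDisjoint : Box → Box → Set
InteriorDisjoint a b =
  (bx a + bw a ≤ bx b) ⊎ (bx b + bw b ≤ bx a) ⊎
  (by a + bh a ≤ by b) ⊎ (by b + bh b ≤ by a)

_⊑_ : Box → Box → Set
a ⊑ b = (bx b ≤ bx a) × (bx a + bw a ≤ bx b + bw b) ×
        (by b ≤ by a) × (by a + bh a ≤ by b + bh b)

knapsack : ℕ → Box
knapsack m = box 0ℚ (toℚ (sideN m)) 0ℚ (toℚ (sideN m))

-- a placement: the lower-left corner of every item (placement by translation)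
Placement : ℕ → Set
Placement m = Item m → ℚ × ℚ

boxOf : ∀ {m} → Placement m → Item m → Box
boxOf p it with p it
... | (x , y) = box x (toℚ (widthℕ it)) y (toℚ (heightℕ it))

IsPacking : ∀ {m} → SubInstance m → Placement m → Set
IsPacking {m} I' p =
  (∀ a → a ∈' I' → boxOf p a ⊑ knapsack m) ×
  (∀ a b → a ∈' I' → b ∈' I' → a ≢ b → InteriorDisjoint (boxOf p a) (boxOf p b))

data Orient : Set where
  vert horiz : Orient   -- vert: vertical cut lines x = c ; horiz: horizontal lines y = c

flip : Orient → Orient
flip vert = horiz
flip horiz = vert

InRegion : ∀ {m} → SubInstance m → Placement m → Box → Item m → Set
InRegion I' p R a = (a ∈' I') × (boxOf p a ⊑ R)

AtMostOne : ∀ {m} → SubInstance m → Placement m → Box → Set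
AtMostOne I' p R = ∀ a b → InRegion I' p R a → InRegion I' p R b → a ≡ b

Avoids : Orient → ℚ → Box → Set
Avoids vert  c a = (bx a + bw a ≤ c) ⊎ (c ≤ bx a)
Avoids horiz c a = (by a + bh a ≤ c) ⊎ (c ≤ by a)

lowEnd highEnd : Orient → Box → ℚ
lowEnd vert R = bx R
lowEnd horiz R = by R
highEnd vert R = bx R + bw R
highEnd horiz R = by R + bh R

slab : Orient → Box → ℚ → ℚ → Box
slab vert  R lo len = box lo len (by R) (bh R)
slab horiz R lo len = box (bx R) (bw R) lo len

open import Data.Rational using (_-_)

Chain : ℚ → List ℚ → ℚ → Set
Chain lo [] hi = lo ≤ hi
Chain lo (c ∷ cs) hi = (lo ≤ c) × Chain c cs hi

pieces : Orient → Box → ℚ → List ℚ → ℚ → List Box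
pieces o R lo [] hi = slab o R lo (hi - lo) ∷ []
pieces o R lo (c ∷ cs) hi = slab o R lo (c - lo) ∷ pieces o R c cs hi

-- A stage may use no cut at all.  After the last stage every piece
-- contains at most one item (the final trimming is implicit).
data Stages {m} (I' : SubInstance m) (p : Placement m) : ℕ → Orient → Box → Set where
  done : ∀ {o R} → AtMostOne I' p R → Stages I' p zero o R
  stage : ∀ {k o R} (cs : List ℚ) →
          Chain (lowEnd o R) cs (highEnd o R) →
          (∀ a → InRegion I' p R a → ∀ c → c ∈ cs → Avoids o c (boxOf p a)) →
          (∀ P → P ∈ pieces o R (lowEnd o R) cs (highEnd o R) → Stages I' p k (flip o) P) →
          Stages I' p (suc k) o R

IsKStagePacking : ∀ {m} → ℕ → SubInstance m → Placement m → Set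
IsKStagePacking {m} k I' p =
  IsPacking I' p × Σ Orient (λ o → Stages I' p k o (knapsack m))

data Guillotine {m} (I' : SubInstance m) (p : Placement m) : Box → Set where
  single : ∀ {R} → AtMostOne I' p R → Guillotine I' p R
  split  : ∀ {R} (o : Orient) (c : ℚ) →
           lowEnd o R < c → c < highEnd o R →
           (∀ a → InRegion I' p R a → Avoids o c (boxOf p a)) →
           Guillotine I' p (slab o R (lowEnd o R) (c - lowEnd o R)) →
           Guillotine I' p (slab o R c (highEnd o R - c)) →
           Guillotine I' p R

-- Container packings (ε is the accuracy parameter of area containers)

data Kind : Set where
  large horizontal vertical area : Kind

XDisjoint YDisjoint : Box → Box → Set
XDisjoint a b = (bx a + bw a ≤ bx b) ⊎ (bx b + bw b ≤ bx a)
YDisjoint a b = (by a + bh a ≤ by b) ⊎ (by b + bh b ≤ by a)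

KindOK : ∀ {m} → ℚ → SubInstance m → Placement m → (Item m → Set) → Kind → Box → Set
KindOK ε I' p inC large C = ∀ a b → inC a → inC b → a ≡ b
KindOK ε I' p inC horizontal C =
  ∀ a b → inC a → inC b → a ≢ b → YDisjoint (boxOf p a) (boxOf p b)
KindOK ε I' p inC vertical C =
  ∀ a b → inC a → inC b → a ≢ b → XDisjoint (boxOf p a) (boxOf p b)
KindOK ε I' p inC area C =
  ∀ a → inC a →
    (toℚ (widthℕ a) ≤ ε * bw C) × (toℚ (heightℕ a) ≤ ε * bh C)

record ContainerPacking {m} (ε : ℚ) (I' : SubInstance m) (p : Placement m) (c : ℕ) : Set where
  field
    container : Fin c → Box
    kind      : Fin c → Kind
    assign    : ∀ a → a ∈' I' → Fin c
    packing   : IsPacking I' p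
    inKnapsack : ∀ i → container i ⊑ knapsack m
    disjoint  : ∀ i j → i ≢ j → InteriorDisjoint (container i) (container j)
    inside    : ∀ a (h : a ∈' I') → boxOf p a ⊑ container (assign a h)
    kindOK    : ∀ i → KindOK ε I' p (λ a → Σ (a ∈' I') (λ h → assign a h ≡ i))
                                 (kind i) (container i)

-- Order the items H₁ < V₁ < H₂ < V₂ < … and place them as a spiral: the item of rank r
-- fills the top strip (H) or the left strip (V) of the region left free by the items
-- of lower rank, so peeling the items off one at a time is a guillotine separation.
--
-- Every item is longer than N/2, so a cut line of one orientation crosses every item of
-- the other shape; two crossed items never end up in different pieces, and an item
-- beside a crossed one has lower rank.  Hence each stage keeps all but the lowest member
-- of an alternating chain inside a single piece, and a k-stage packing admits no
-- alternating chain of k + 1 members followed by a further member.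
--
-- Group the members of I' by rank into maximal runs of equal shape, the last member
-- joining the run before it.  One member from each run gives an alternating chain
-- followed by the last member, so there are at most k runs, and each run fits into one
-- horizontal or vertical container carved out of the spiral.

module Submission where

open import Defs
open import Data.Nat using (ℕ; _≤_)
open import Data.Rational using (ℚ; 0ℚ) renaming (_<_ to _<ℚ_)
open import Data.Product using (Σ; _×_)

open import Data.Bool using (Bool; true; false; if_then_else_)
open import Data.Empty using (⊥; ⊥-elim)
open import Data.Fin as Fin using (toℕ)
import Data.Fin.Properties as Finₚ
import Data.Integer as ℤ
import Data.Integer.Properties as ℤₚ
open import Data.List using ([]; _∷_)
open import Data.List.Membership.Propositional using (_∈_)
open import Data.List.Relation.Unary.Any using (here; there)
open import Data.Maybe as Maybe using (Maybe; just; nothing; _<∣>_; _>>=_)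
import Data.Maybe.Properties as Maybeₚ
open import Data.Nat using (zero; suc; _+_; _∸_; _^_; _<_; _⊓_; _≤′_; _≤?_; z≤n; s≤s; ⌊_/2⌋; ⌈_/2⌉)
open import Data.Nat.Base using (≤′-refl; ≤′-step)
import Data.Nat.Coprimality as Coprimality
import Data.Nat.Properties as ℕₚ
open import Data.Nat.Tactic.RingSolver using (solve-∀)
open import Data.Product using (_,_; proj₁; proj₂)
open import Data.Rational using (mkℚ) renaming (_≤_ to _≤ℚ_; _+_ to _+ℚ_; _-_ to _-ℚ_)
import Data.Rational as ℚ
import Data.Rational.Properties as ℚₚ
import Data.Rational.Unnormalised as ℚᵘ
import Data.Rational.Unnormalised.Properties as ℚᵘₚ
open import Data.Sum using (_⊎_; inj₁; inj₂; [_,_]′; swap)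
open import Function using (_∘_)
open import Relation.Binary.Definitions using (tri<; tri≈; tri>)
open import Relation.Binary.PropositionalEquality
open import Relation.Nullary using (¬_; Dec; yes; no; does)
open import Relation.Unary using (Decidable)
open import Algebra.Properties.AbelianGroup ℚₚ.+-0-abelianGroup using (xyx⁻¹≈y)

toℚ≡mkℚ : ∀ n → toℚ n ≡ mkℚ (ℤ.+ n) 0 (Coprimality.sym (Coprimality.1-coprimeTo n))
toℚ≡mkℚ n = ℚₚ.normalize-coprime _

toℚ-+ : ∀ a b → toℚ (a + b) ≡ toℚ a +ℚ toℚ b
toℚ-+ a b = ℚₚ.toℚᵘ-injective
  (ℚᵘₚ.≃-trans unnormalised (ℚᵘₚ.≃-sym (ℚₚ.toℚᵘ-homo-+ (toℚ a) (toℚ b))))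
  where
  unnormalised : ℚ.toℚᵘ (toℚ (a + b)) ℚᵘ.≃ (ℚ.toℚᵘ (toℚ a) ℚᵘ.+ ℚ.toℚᵘ (toℚ b))
  unnormalised rewrite toℚ≡mkℚ a | toℚ≡mkℚ b | toℚ≡mkℚ (a + b)
    | ℤₚ.*-identityʳ (ℤ.+ a) | ℤₚ.*-identityʳ (ℤ.+ b) = ℚᵘ.*≡* refl

toℚ-mono-≤ : ∀ {a b} → a ≤ b → toℚ a ≤ℚ toℚ b
toℚ-mono-≤ {a} {b} a≤b rewrite toℚ≡mkℚ a | toℚ≡mkℚ b =
  ℚ.*≤* (ℤₚ.*-monoʳ-≤-nonNeg (ℤ.+ 1) (ℤ.+≤+ a≤b))

toℚ-cancel-≤ : ∀ {a b} → toℚ a ≤ℚ toℚ b → a ≤ b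
toℚ-cancel-≤ {a} {b} le rewrite toℚ≡mkℚ a | toℚ≡mkℚ b with le
... | ℚ.*≤* p rewrite ℤₚ.*-identityʳ (ℤ.+ a) | ℤₚ.*-identityʳ (ℤ.+ b) = ℤₚ.drop‿+≤+ p

toℚ-mono-< : ∀ {a b} → a < b → toℚ a <ℚ toℚ b
toℚ-mono-< {a} {b} a<b rewrite toℚ≡mkℚ a | toℚ≡mkℚ b =
  ℚ.*<* (subst₂ ℤ._<_ (sym (ℤₚ.*-identityʳ (ℤ.+ a))) (sym (ℤₚ.*-identityʳ (ℤ.+ b))) (ℤ.+<+ a<b))

toℚ-+-≤ : ∀ {a b c} → a + b ≤ c → toℚ a +ℚ toℚ b ≤ℚ toℚ c
toℚ-+-≤ {a} {b} le = subst (_≤ℚ _) (toℚ-+ a b) (toℚ-mono-≤ le)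

toℚ-+-mono-≤ : ∀ {a b c d} → a + b ≤ c + d → toℚ a +ℚ toℚ b ≤ℚ toℚ c +ℚ toℚ d
toℚ-+-mono-≤ {a} {b} {c} {d} le = subst₂ _≤ℚ_ (toℚ-+ a b) (toℚ-+ c d) (toℚ-mono-≤ le)

toℚ-+-cancel-≤ : ∀ {a b c d} → toℚ a +ℚ toℚ b ≤ℚ toℚ c +ℚ toℚ d → a + b ≤ c + d
toℚ-+-cancel-≤ {a} {b} {c} {d} le = toℚ-cancel-≤ (subst₂ _≤ℚ_ (sym (toℚ-+ a b)) (sym (toℚ-+ c d)) le)

+-[-]-cancel : ∀ x y → x +ℚ (y -ℚ x) ≡ y
+-[-]-cancel x y = trans (sym (ℚₚ.+-assoc x y (ℚ.- x))) (xyx⁻¹≈y x y)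

toℚ-∸ : ∀ {a b} → b ≤ a → toℚ a -ℚ toℚ b ≡ toℚ (a ∸ b)
toℚ-∸ {a} {b} b≤a = begin
  toℚ a -ℚ toℚ b                  ≡⟨ cong (λ z → toℚ z -ℚ toℚ b) (sym (ℕₚ.m+[n∸m]≡n b≤a)) ⟩
  toℚ (b + (a ∸ b)) -ℚ toℚ b      ≡⟨ cong (_-ℚ toℚ b) (toℚ-+ b (a ∸ b)) ⟩
  toℚ b +ℚ toℚ (a ∸ b) -ℚ toℚ b   ≡⟨ xyx⁻¹≈y (toℚ b) (toℚ (a ∸ b)) ⟩
  toℚ (a ∸ b)                     ∎
  where open ≡-Reasoning

record IBox : Set where
  constructor ibox
  field ix iw iy ih : ℕ
open IBox

⟦_⟧ : IBox → Box
⟦ ibox x w y h ⟧ = box (toℚ x) (toℚ w) (toℚ y) (toℚ h)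

_⊑ᴵ_ : IBox → IBox → Set
a ⊑ᴵ b = (ix b ≤ ix a) × (ix a + iw a ≤ ix b + iw b) ×
         (iy b ≤ iy a) × (iy a + ih a ≤ iy b + ih b)

⊑ᴵ-refl : ∀ {a} → a ⊑ᴵ a
⊑ᴵ-refl = ℕₚ.≤-refl , ℕₚ.≤-refl , ℕₚ.≤-refl , ℕₚ.≤-refl

⊑ᴵ-trans : ∀ {a b c} → a ⊑ᴵ b → b ⊑ᴵ c → a ⊑ᴵ c
⊑ᴵ-trans (p₁ , p₂ , p₃ , p₄) (q₁ , q₂ , q₃ , q₄) =
  ℕₚ.≤-trans q₁ p₁ , ℕₚ.≤-trans p₂ q₂ , ℕₚ.≤-trans q₃ p₃ , ℕₚ.≤-trans p₄ q₄

⟦⟧-mono-⊑ : ∀ {a b} → a ⊑ᴵ b → ⟦ a ⟧ ⊑ ⟦ b ⟧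
⟦⟧-mono-⊑ {ibox x w y h} {ibox x' w' y' h'} (p₁ , p₂ , p₃ , p₄) =
  toℚ-mono-≤ p₁ , toℚ-+-mono-≤ {x} {w} {x'} {w'} p₂ ,
  toℚ-mono-≤ p₃ , toℚ-+-mono-≤ {y} {h} {y'} {h'} p₄

⟦⟧-cancel-⊑ : ∀ {a b} → ⟦ a ⟧ ⊑ ⟦ b ⟧ → a ⊑ᴵ b
⟦⟧-cancel-⊑ {ibox x w y h} {ibox x' w' y' h'} (p₁ , p₂ , p₃ , p₄) =
  toℚ-cancel-≤ p₁ , toℚ-+-cancel-≤ {x} {w} {x'} {w'} p₂ ,
  toℚ-cancel-≤ p₃ , toℚ-+-cancel-≤ {y} {h} {y'} {h'} p₄

Disjointᴵ : IBox → IBox → Set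
Disjointᴵ a b = (ix a + iw a ≤ ix b) ⊎ (ix b + iw b ≤ ix a) ⊎
                 (iy a + ih a ≤ iy b) ⊎ (iy b + ih b ≤ iy a)

Disjointᴵ-sym : ∀ {a b} → Disjointᴵ a b → Disjointᴵ b a
Disjointᴵ-sym (inj₁ p)               = inj₂ (inj₁ p)
Disjointᴵ-sym (inj₂ (inj₁ p))        = inj₁ p
Disjointᴵ-sym (inj₂ (inj₂ (inj₁ p))) = inj₂ (inj₂ (inj₂ p))
Disjointᴵ-sym (inj₂ (inj₂ (inj₂ p))) = inj₂ (inj₂ (inj₁ p))

⟦⟧-disjoint : ∀ {a b} → Disjointᴵ a b → InteriorDisjoint ⟦ a ⟧ ⟦ b ⟧
⟦⟧-disjoint {ibox x w y h} {ibox x' w' y' h'} (inj₁ p)               = inj₁ (toℚ-+-≤ {x} {w} p)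
⟦⟧-disjoint {ibox x w y h} {ibox x' w' y' h'} (inj₂ (inj₁ p))        = inj₂ (inj₁ (toℚ-+-≤ {x'} {w'} p))
⟦⟧-disjoint {ibox x w y h} {ibox x' w' y' h'} (inj₂ (inj₂ (inj₁ p))) = inj₂ (inj₂ (inj₁ (toℚ-+-≤ {y} {h} p)))
⟦⟧-disjoint {ibox x w y h} {ibox x' w' y' h'} (inj₂ (inj₂ (inj₂ p))) = inj₂ (inj₂ (inj₂ (toℚ-+-≤ {y'} {h'} p)))

Beyond : Orient → IBox → IBox → Set
Beyond horiz S B = iy S + ih S ≤ iy B
Beyond vert  S B = ix B + iw B ≤ ix S

carve : Orient → IBox → IBox → IBox
carve horiz R S = ibox (ix R) (iw R) (iy S + ih S) (iy R + ih R ∸ (iy S + ih S))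
carve vert  R S = ibox (ix R) (ix S ∸ ix R) (iy R) (ih R)

beyond-⊑ : ∀ o {S T B} → T ⊑ᴵ S → Beyond o S B → Beyond o T B
beyond-⊑ horiz (_ , _ , _ , T≤S) beyond = ℕₚ.≤-trans T≤S beyond
beyond-⊑ vert  (S≤T , _ , _ , _) beyond = ℕₚ.≤-trans beyond S≤T

beyond⇒disjoint : ∀ o {S B} → Beyond o S B → Disjointᴵ B S
beyond⇒disjoint horiz beyond = inj₂ (inj₂ (inj₂ beyond))
beyond⇒disjoint vert  beyond = inj₁ beyond

beyond-not-inside : ∀ o {S B} → 0 < iw B → 0 < ih B → Beyond o S B → B ⊑ᴵ S → ⊥
beyond-not-inside horiz _   h>0 beyond (_ , _ , _ , top≤) =
  ℕₚ.<⇒≱ (ℕₚ.m<m+n _ h>0) (ℕₚ.≤-trans top≤ beyond)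
beyond-not-inside vert  w>0 _   beyond (left≤ , _ , _ , _) =
  ℕₚ.<⇒≱ (ℕₚ.m<m+n _ w>0) (ℕₚ.≤-trans beyond left≤)

carve-⊑ : ∀ o {R S} → S ⊑ᴵ R → carve o R S ⊑ᴵ R
carve-⊑ horiz (_ , _ , R≤S , S≤R) =
  ℕₚ.≤-refl , ℕₚ.≤-refl , ℕₚ.≤-trans R≤S (ℕₚ.m≤m+n _ _) , ℕₚ.≤-reflexive (ℕₚ.m+[n∸m]≡n S≤R)
carve-⊑ vert  (R≤S , S≤R , _ , _) =
  ℕₚ.≤-refl , ℕₚ.≤-trans (ℕₚ.≤-reflexive (ℕₚ.m+[n∸m]≡n R≤S)) (ℕₚ.≤-trans (ℕₚ.m≤m+n _ _) S≤R) ,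
  ℕₚ.≤-refl , ℕₚ.≤-refl

⊑-carve : ∀ o {R S B} → B ⊑ᴵ R → Beyond o S B → B ⊑ᴵ carve o R S
⊑-carve horiz (p₁ , p₂ , p₃ , p₄) beyond =
  p₁ , p₂ , beyond , ℕₚ.≤-trans p₄ (ℕₚ.≤-reflexive (sym (ℕₚ.m+[n∸m]≡n
                        (ℕₚ.≤-trans beyond (ℕₚ.≤-trans (ℕₚ.m≤m+n _ _) p₄)))))
⊑-carve vert  (p₁ , p₂ , p₃ , p₄) beyond =
  p₁ , ℕₚ.≤-trans beyond (ℕₚ.≤-reflexive (sym (ℕₚ.m+[n∸m]≡n
          (ℕₚ.≤-trans p₁ (ℕₚ.≤-trans (ℕₚ.m≤m+n _ _) beyond))))) , p₃ , p₄

carve-disjoint : ∀ o {R S T} → S ⊑ᴵ R → T ⊑ᴵ S → Disjointᴵ (carve o R S) T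
carve-disjoint horiz _ (_ , _ , _ , T≤S) = inj₂ (inj₂ (inj₂ T≤S))
carve-disjoint vert  (R≤S , _ , _ , _) (S≤T , _ , _ , _) =
  inj₁ (ℕₚ.≤-trans (ℕₚ.≤-reflexive (ℕₚ.m+[n∸m]≡n R≤S)) S≤T)

Across : Orient → Box → Box → Set
Across vert  B R = (by R ≤ℚ by B) × (by B +ℚ bh B ≤ℚ by R +ℚ bh R)
Across horiz B R = (bx R ≤ℚ bx B) × (bx B +ℚ bw B ≤ℚ bx R +ℚ bw R)

⊑⇒within : ∀ o {B R} → B ⊑ R →
           (lowEnd o R ≤ℚ lowEnd o B) × (highEnd o B ≤ℚ highEnd o R) × Across o B R
⊑⇒within vert  (p₁ , p₂ , p₃ , p₄) = p₁ , p₂ , p₃ , p₄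
⊑⇒within horiz (p₁ , p₂ , p₃ , p₄) = p₃ , p₄ , p₁ , p₂

⊑-slab : ∀ o {B R lo len} → lo ≤ℚ lowEnd o B → highEnd o B ≤ℚ lo +ℚ len → Across o B R →
         B ⊑ slab o R lo len
⊑-slab vert  lo≤ ≤hi (p₁ , p₂) = lo≤ , ≤hi , p₁ , p₂
⊑-slab horiz lo≤ ≤hi (p₁ , p₂) = p₁ , p₂ , lo≤ , ≤hi

avoids⇒beside : ∀ o {c B} → Avoids o c B → (highEnd o B ≤ℚ c) ⊎ (c ≤ℚ lowEnd o B)
avoids⇒beside vert  av = av
avoids⇒beside horiz av = av

lowEnd-slab : ∀ o R lo len → lowEnd o (slab o R lo len) ≡ lo
lowEnd-slab vert  R lo len = refl
lowEnd-slab horiz R lo len = refl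

highEnd-slab : ∀ o R lo len → highEnd o (slab o R lo len) ≡ lo +ℚ len
highEnd-slab vert  R lo len = refl
highEnd-slab horiz R lo len = refl

module _ (o : Orient) (R : Box) {B : Box} (across : Across o B R) where

  private
    ⊑-slab-upTo : ∀ {lo c} → lo ≤ℚ lowEnd o B → highEnd o B ≤ℚ c → B ⊑ slab o R lo (c -ℚ lo)
    ⊑-slab-upTo {lo} {c} lo≤ ≤c = ⊑-slab o lo≤ (subst (highEnd o B ≤ℚ_) (sym (+-[-]-cancel lo c)) ≤c) across

  pieces-start-above : ∀ lo cs hi → Chain lo cs hi →
                       ∀ {P} → P ∈ pieces o R lo cs hi → lo ≤ℚ lowEnd o P
  pieces-start-above lo []       hi _          (here refl) = ℚₚ.≤-reflexive (sym (lowEnd-slab o R lo (hi -ℚ lo)))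
  pieces-start-above lo (c ∷ cs) hi _          (here refl) = ℚₚ.≤-reflexive (sym (lowEnd-slab o R lo (c -ℚ lo)))
  pieces-start-above lo (c ∷ cs) hi (lo≤c , ch) (there P∈) = ℚₚ.≤-trans lo≤c (pieces-start-above c cs hi ch P∈)

  piece-containing : ∀ lo cs hi → Chain lo cs hi → lo ≤ℚ lowEnd o B → highEnd o B ≤ℚ hi →
                     (∀ c → c ∈ cs → Avoids o c B) →
                     Σ Box (λ P → P ∈ pieces o R lo cs hi × B ⊑ P)
  piece-containing lo []       hi _          lo≤ ≤hi av = _ , here refl , ⊑-slab-upTo lo≤ ≤hi
  piece-containing lo (c ∷ cs) hi (_ , ch)   lo≤ ≤hi av with avoids⇒beside o (av c (here refl))
  ... | inj₁ ≤c = _ , here refl , ⊑-slab-upTo lo≤ ≤c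
  ... | inj₂ c≤ with piece-containing c cs hi ch c≤ ≤hi (λ c' c'∈ → av c' (there c'∈))
  ...   | P , P∈ , B⊑P = P , there P∈ , B⊑P

  inside-or-beside : ∀ lo cs hi → Chain lo cs hi → lo ≤ℚ lowEnd o B → highEnd o B ≤ℚ hi →
                     (∀ c → c ∈ cs → Avoids o c B) → ∀ {P} → P ∈ pieces o R lo cs hi →
                     (B ⊑ P) ⊎ (highEnd o B ≤ℚ lowEnd o P) ⊎ (highEnd o P ≤ℚ lowEnd o B)
  inside-or-beside lo []       hi _  lo≤ ≤hi av (here refl) = inj₁ (⊑-slab-upTo lo≤ ≤hi)
  inside-or-beside lo (c ∷ cs) hi ch lo≤ ≤hi av P∈ with avoids⇒beside o (av c (here refl)) | ch | P∈
  ... | inj₁ ≤c | _        | here refl = inj₁ (⊑-slab-upTo lo≤ ≤c)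
  ... | inj₁ ≤c | (_ , ch') | there P∈' = inj₂ (inj₁ (ℚₚ.≤-trans ≤c (pieces-start-above c cs hi ch' P∈')))
  ... | inj₂ c≤ | _        | here refl =
    inj₂ (inj₂ (subst (_≤ℚ lowEnd o B) (sym (trans (highEnd-slab o R lo (c -ℚ lo)) (+-[-]-cancel lo c))) c≤))
  ... | inj₂ c≤ | (_ , ch') | there P∈' =
    inside-or-beside c cs hi ch' c≤ ≤hi (λ c' c'∈ → av c' (there c'∈)) P∈'

mersenne : ℕ → ℕ
mersenne n = 2 ^ n ∸ 1

mersenne+1 : ∀ n → mersenne n + 1 ≡ 2 ^ n
mersenne+1 n = ℕₚ.m∸n+n≡m (ℕₚ.m^n>0 2 n)

mersenne<2^ : ∀ n → mersenne n < 2 ^ n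
mersenne<2^ n = subst (mersenne n <_) (trans (ℕₚ.+-comm 1 (mersenne n)) (mersenne+1 n)) ℕₚ.≤-refl

mersenne-suc : ∀ n → mersenne (suc n) ≡ mersenne n + 2 ^ n
mersenne-suc n = ℕₚ.+-cancelʳ-≡ 1 _ _ (begin
  mersenne (suc n) + 1       ≡⟨ mersenne+1 (suc n) ⟩
  2 ^ n + (2 ^ n + 0)        ≡⟨ cong (_+ (2 ^ n + 0)) (sym (mersenne+1 n)) ⟩
  mersenne n + 1 + (2 ^ n + 0) ≡⟨ shuffle (mersenne n) (2 ^ n) ⟩
  mersenne n + 2 ^ n + 1     ∎)
  where
  open ≡-Reasoning
  shuffle : ∀ a b → a + 1 + (b + 0) ≡ a + b + 1
  shuffle = solve-∀

mersenne-mono : ∀ {a b} → a ≤ b → mersenne a ≤ mersenne b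
mersenne-mono a≤b = ℕₚ.∸-monoˡ-≤ 1 (ℕₚ.^-monoʳ-≤ 2 a≤b)

mersenne<mersenne-suc : ∀ n → mersenne n < mersenne (suc n)
mersenne<mersenne-suc n = subst (mersenne n <_) (sym (mersenne-suc n))
  (ℕₚ.≤-trans (ℕₚ.≤-reflexive (ℕₚ.+-comm 1 (mersenne n))) (ℕₚ.+-monoʳ-≤ (mersenne n) (ℕₚ.m^n>0 2 n)))

2^-cancel-< : ∀ {a b} → 2 ^ a < 2 ^ b → a < b
2^-cancel-< 2^a<2^b = ℕₚ.≰⇒> (λ b≤a → ℕₚ.<⇒≱ 2^a<2^b (ℕₚ.^-monoʳ-≤ 2 b≤a))

∸+∸-exceeds : ∀ {N a b} → a ≤ N → b ≤ N → a + b < N → N < (N ∸ a) + (N ∸ b)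
∸+∸-exceeds {N} {a} {b} a≤N b≤N a+b<N = ℕₚ.+-cancelʳ-< (a + b) N _ (begin-strict
  N + (a + b)                       <⟨ ℕₚ.+-monoʳ-< N a+b<N ⟩
  N + N                             ≡⟨ cong₂ _+_ (sym (ℕₚ.m∸n+n≡m a≤N)) (sym (ℕₚ.m∸n+n≡m b≤N)) ⟩
  (N ∸ a + a) + (N ∸ b + b)         ≡⟨ shuffle (N ∸ a) a (N ∸ b) b ⟩
  (N ∸ a) + (N ∸ b) + (a + b)       ∎)
  where
  open ℕₚ.≤-Reasoning
  shuffle : ∀ x a y b → (x + a) + (y + b) ≡ (x + y) + (a + b)
  shuffle = solve-∀

module Sizes (m : ℕ) where

  N : ℕ
  N = sideN m

  N≡2^m+2^m : N ≡ 2 ^ m + 2 ^ m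
  N≡2^m+2^m = cong (2 ^ m +_) (ℕₚ.+-identityʳ (2 ^ m))

  mersenne≤N : ∀ {n} → n ≤ suc m → mersenne n ≤ N
  mersenne≤N n≤ = ℕₚ.≤-trans (ℕₚ.m∸n≤m _ 1) (ℕₚ.^-monoʳ-≤ 2 n≤)

  mersenne<N : ∀ {n} → n ≤ m → mersenne n < N
  mersenne<N {n} n≤m = ℕₚ.<-≤-trans (mersenne<2^ n)
    (ℕₚ.≤-trans (ℕₚ.^-monoʳ-≤ 2 n≤m) (subst (2 ^ m ≤_) (sym N≡2^m+2^m) (ℕₚ.m≤m+n _ _)))

  wide+wide-exceeds : ∀ {n n'} → n ≤ m → n' ≤ m → N < (N ∸ mersenne n) + (N ∸ mersenne n')
  wide+wide-exceeds {n} {n'} n≤m n'≤m =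
    ∸+∸-exceeds (ℕₚ.<⇒≤ (mersenne<N n≤m)) (ℕₚ.<⇒≤ (mersenne<N n'≤m)) (begin-strict
      mersenne n + mersenne n'   <⟨ ℕₚ.+-mono-<-≤ (mersenne<2^ n) (ℕₚ.<⇒≤ (mersenne<2^ n')) ⟩
      2 ^ n + 2 ^ n'             ≤⟨ ℕₚ.+-mono-≤ (ℕₚ.^-monoʳ-≤ 2 n≤m) (ℕₚ.^-monoʳ-≤ 2 n'≤m) ⟩
      2 ^ m + 2 ^ m              ≡⟨ sym N≡2^m+2^m ⟩
      N                          ∎)
    where open ℕₚ.≤-Reasoning

  narrow-beside-wide : ∀ {j n} → n ≤ suc m → 2 ^ j + (N ∸ mersenne n) ≤ N → j < n
  narrow-beside-wide {j} {n} n≤ fits = 2^-cancel-< (ℕₚ.≤-<-trans 2^j≤ (mersenne<2^ n))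
    where
    2^j≤ : 2 ^ j ≤ mersenne n
    2^j≤ = ℕₚ.+-cancelʳ-≤ (N ∸ mersenne n) (2 ^ j) (mersenne n)
             (ℕₚ.≤-trans fits (ℕₚ.≤-reflexive (trans (sym (ℕₚ.m∸n+n≡m (mersenne≤N n≤)))
                                                     (ℕₚ.+-comm (N ∸ mersenne n) (mersenne n)))))

double : ℕ → ℕ
double zero    = zero
double (suc n) = suc (suc (double n))

double-mono : ∀ {a b} → a ≤ b → double a ≤ double b
double-mono z≤n       = z≤n
double-mono (s≤s a≤b) = s≤s (s≤s (double-mono a≤b))

1+double<double : ∀ {a b} → a < b → suc (double a) < double b
1+double<double {b = suc b} (s≤s a≤b) = s≤s (s≤s (double-mono a≤b))

⌊double/2⌋ : ∀ n → ⌊ double n /2⌋ ≡ n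
⌊double/2⌋ zero    = refl
⌊double/2⌋ (suc n) = cong suc (⌊double/2⌋ n)

⌈double/2⌉ : ∀ n → ⌈ double n /2⌉ ≡ n
⌈double/2⌉ zero    = refl
⌈double/2⌉ (suc n) = cong suc (⌈double/2⌉ n)

module _ {m : ℕ} where

  shape : Item m → Orient
  shape (H _) = horiz
  shape (V _) = vert

  layer : Item m → ℕ
  layer (H i) = toℕ i
  layer (V i) = toℕ i

  rank : Item m → ℕ
  rank (H i) = double (toℕ i)
  rank (V i) = suc (double (toℕ i))

_≟ₒ_ : (o o' : Orient) → Dec (o ≡ o')
vert  ≟ₒ vert  = yes refl
horiz ≟ₒ horiz = yes refl
vert  ≟ₒ horiz = no λ ()
horiz ≟ₒ vert  = no λ ()

liftItem : ∀ {m} → Item m → Item (suc m)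
liftItem (H i) = H (Fin.suc i)
liftItem (V i) = V (Fin.suc i)

itemOfRank : ∀ m → ℕ → Maybe (Item m)
itemOfRank zero    r             = nothing
itemOfRank (suc m) zero          = just (H Fin.zero)
itemOfRank (suc m) (suc zero)    = just (V Fin.zero)
itemOfRank (suc m) (suc (suc r)) = Maybe.map liftItem (itemOfRank m r)

itemOfRank-rank : ∀ {m} (a : Item m) → itemOfRank m (rank a) ≡ just a
itemOfRank-rank {suc m} (H Fin.zero)    = refl
itemOfRank-rank {suc m} (V Fin.zero)    = refl
itemOfRank-rank {suc m} (H (Fin.suc i)) = cong (Maybe.map liftItem) (itemOfRank-rank (H i))
itemOfRank-rank {suc m} (V (Fin.suc i)) = cong (Maybe.map liftItem) (itemOfRank-rank (V i))

rank-liftItem : ∀ {m} (a : Item m) → rank (liftItem a) ≡ suc (suc (rank a))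
rank-liftItem (H i) = refl
rank-liftItem (V i) = refl

itemOfRank⇒rank : ∀ {m} r {a : Item m} → itemOfRank m r ≡ just a → rank a ≡ r
itemOfRank⇒rank {suc m} zero          {H Fin.zero} refl = refl
itemOfRank⇒rank {suc m} (suc zero)    {V Fin.zero} refl = refl
itemOfRank⇒rank {suc m} (suc (suc r)) eq with itemOfRank m r in eq'
itemOfRank⇒rank {suc m} (suc (suc r)) refl | just b =
  trans (rank-liftItem b) (cong (λ z → suc (suc z)) (itemOfRank⇒rank r eq'))

rank-injective : ∀ {m} {a b : Item m} → rank a ≡ rank b → a ≡ b
rank-injective {m} {a} {b} eq = Maybeₚ.just-injective
  (trans (sym (itemOfRank-rank a)) (trans (cong (itemOfRank m) eq) (itemOfRank-rank b)))

rank<double : ∀ {m} (a : Item m) → rank a < double m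
rank<double {suc m} (H Fin.zero)    = s≤s z≤n
rank<double {suc m} (V Fin.zero)    = s≤s (s≤s z≤n)
rank<double {suc m} (H (Fin.suc i)) = s≤s (s≤s (rank<double (H i)))
rank<double {suc m} (V (Fin.suc i)) = s≤s (s≤s (rank<double (V i)))

rank-surjective : ∀ m {r} → r < double m → Σ (Item m) (λ a → rank a ≡ r)
rank-surjective (suc m) {zero}          _               = H Fin.zero , refl
rank-surjective (suc m) {suc zero}      _               = V Fin.zero , refl
rank-surjective (suc m) {suc (suc r)} (s≤s (s≤s r<)) with rank-surjective m r<
... | a , refl = liftItem a , rank-liftItem a

crossedBy : ∀ {m} → Orient → Item m → Bool
crossedBy vert  (H _) = true
crossedBy vert  (V _) = false
crossedBy horiz (H _) = false
crossedBy horiz (V _) = true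

extent : ∀ {m} → Orient → Item m → ℕ
extent vert  a = widthℕ a
extent horiz a = heightℕ a

one-crossed : ∀ {m} o {y x : Item m} → shape y ≢ shape x → crossedBy o x ≡ true ⊎ crossedBy o y ≡ true
one-crossed vert  {y}   {H _} _  = inj₁ refl
one-crossed vert  {H _} {V _} _  = inj₂ refl
one-crossed vert  {V _} {V _} ne = ⊥-elim (ne refl)
one-crossed horiz {y}   {V _} _  = inj₁ refl
one-crossed horiz {V _} {H _} _  = inj₂ refl
one-crossed horiz {H _} {H _} ne = ⊥-elim (ne refl)

module _ (m : ℕ) where
  open Sizes m

  crossed-inseparable : ∀ o (a b : Item m) → crossedBy o a ≡ true → crossedBy o b ≡ true →
                        N < extent o a + extent o b
  crossed-inseparable vert  (H i) (H j) _ _ =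
    wide+wide-exceeds (ℕₚ.<⇒≤ (Finₚ.toℕ<n i)) (ℕₚ.<⇒≤ (Finₚ.toℕ<n j))
  crossed-inseparable horiz (V i) (V j) _ _ = wide+wide-exceeds (Finₚ.toℕ<n i) (Finₚ.toℕ<n j)

  beside-crossed⇒rank< : ∀ o (a b : Item m) → crossedBy o a ≡ false → crossedBy o b ≡ true →
                          extent o a + extent o b ≤ N → rank a < rank b
  beside-crossed⇒rank< vert  (V j) (H i) _ _ fits =
    1+double<double (narrow-beside-wide {toℕ j} (ℕₚ.m≤n⇒m≤1+n (ℕₚ.<⇒≤ (Finₚ.toℕ<n i))) fits)
  beside-crossed⇒rank< horiz (H i) (V j) _ _ fits =
    s≤s (double-mono (ℕₚ.≤-pred (narrow-beside-wide {toℕ i} (ℕₚ.m≤n⇒m≤1+n (Finₚ.toℕ<n j)) fits)))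

data Zigzag {m} (S : Item m → Set) : ℕ → Item m → Set where
  start  : ∀ {x} → S x → Zigzag S zero x
  extend : ∀ {n y x} → Zigzag S n y → S x → rank y < rank x → shape y ≢ shape x → Zigzag S (suc n) x

top-member : ∀ {m} {S : Item m → Set} {n x} → Zigzag S n x → S x
top-member (start Sx)        = Sx
top-member (extend _ Sx _ _) = Sx

retop : ∀ {m} {S : Item m → Set} {n y a} → Zigzag S n y → S a → rank y < rank a → shape y ≡ shape a →
        Zigzag S n a
retop (start _)            Sa _   _    = start Sa
retop (extend zz _ z<y z≁y) Sa y<a same =
  extend zz Sa (ℕₚ.<-trans z<y y<a) (λ z≡a → z≁y (trans z≡a (sym same)))

zigzag-map : ∀ {m} {S T : Item m → Set} → (∀ {a} → S a → T a) → ∀ {n x} → Zigzag S n x → Zigzag T n x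
zigzag-map f (start Sx)               = start (f Sx)
zigzag-map f (extend zz Sx y<x y≁x) = extend (zigzag-map f zz) (f Sx) y<x y≁x

module StageLowerBound {m : ℕ} (I' : SubInstance m) (p : Placement m)
         (inKnapsack : ∀ a → a ∈' I' → boxOf p a ⊑ knapsack m) where
  open Sizes m

  InR : Box → Item m → Set
  InR = InRegion I' p

  highEnd-boxOf : ∀ o a → highEnd o (boxOf p a) ≡ lowEnd o (boxOf p a) +ℚ toℚ (extent o a)
  highEnd-boxOf vert  a = refl
  highEnd-boxOf horiz a = refl

  inKnapsack-along : ∀ o {a} → a ∈' I' →
                     (0ℚ ≤ℚ lowEnd o (boxOf p a)) × (highEnd o (boxOf p a) ≤ℚ 0ℚ +ℚ toℚ N)
  inKnapsack-along vert  a∈ = let (p₁ , p₂ , _ , _) = inKnapsack _ a∈ in p₁ , p₂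
  inKnapsack-along horiz a∈ = let (_ , _ , p₃ , p₄) = inKnapsack _ a∈ in p₃ , p₄

  Beside : Orient → Item m → Item m → Set
  Beside o a b = (highEnd o (boxOf p a) ≤ℚ lowEnd o (boxOf p b)) ⊎ (highEnd o (boxOf p b) ≤ℚ lowEnd o (boxOf p a))

  before⇒extents≤N : ∀ o {a b} → a ∈' I' → b ∈' I' → highEnd o (boxOf p a) ≤ℚ lowEnd o (boxOf p b) →
                     extent o a + extent o b ≤ N
  before⇒extents≤N o {a} {b} a∈ b∈ a≤b = toℚ-+-cancel-≤ {extent o a} {extent o b} {0} {N} (begin
    toℚ (extent o a) +ℚ toℚ (extent o b)                        ≤⟨ ℚₚ.+-monoˡ-≤ _ (ℚₚ.≤-trans a-from-0 a≤b) ⟩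
    lowEnd o (boxOf p b) +ℚ toℚ (extent o b)                    ≡⟨ sym (highEnd-boxOf o b) ⟩
    highEnd o (boxOf p b)                                      ≤⟨ proj₂ (inKnapsack-along o b∈) ⟩
    0ℚ +ℚ toℚ N                                                ∎)
    where
    open ℚₚ.≤-Reasoning
    a-from-0 : toℚ (extent o a) ≤ℚ highEnd o (boxOf p a)
    a-from-0 = subst₂ _≤ℚ_ (ℚₚ.+-identityˡ _) (sym (highEnd-boxOf o a))
                 (ℚₚ.+-monoˡ-≤ _ (proj₁ (inKnapsack-along o a∈)))

  beside⇒extents≤N : ∀ o {a b} → a ∈' I' → b ∈' I' → Beside o a b → extent o a + extent o b ≤ N
  beside⇒extents≤N o     a∈ b∈ (inj₁ a≤b) = before⇒extents≤N o a∈ b∈ a≤b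
  beside⇒extents≤N o {a} {b} a∈ b∈ (inj₂ b≤a) =
    subst (_≤ N) (ℕₚ.+-comm (extent o b) (extent o a)) (before⇒extents≤N o b∈ a∈ b≤a)

  module InStage {o R cs} (chain : Chain (lowEnd o R) cs (highEnd o R))
                 (avoid : ∀ a → InR R a → ∀ c → c ∈ cs → Avoids o c (boxOf p a)) where

    Piece : Box → Set
    Piece P = P ∈ pieces o R (lowEnd o R) cs (highEnd o R)

    piece-of : ∀ a → InR R a → Σ Box (λ P → Piece P × boxOf p a ⊑ P)
    piece-of a (a∈ , a⊑R) = let (lo≤ , ≤hi , across) = ⊑⇒within o a⊑R in
      piece-containing o R across _ cs _ chain lo≤ ≤hi (avoid a (a∈ , a⊑R))

    module _ {P} (P∈ : Piece P) {w} (wR : InR R w) (w⊑P : boxOf p w ⊑ P)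
             (w-crossed : crossedBy o w ≡ true) where

      Outside : Item m → Set
      Outside a = (highEnd o (boxOf p a) ≤ℚ lowEnd o P) ⊎ (highEnd o P ≤ℚ lowEnd o (boxOf p a))

      inside-or-outside : ∀ a → InR R a → (boxOf p a ⊑ P) ⊎ Outside a
      inside-or-outside a (a∈ , a⊑R) = let (lo≤ , ≤hi , across) = ⊑⇒within o a⊑R in
        inside-or-beside o R across _ cs _ chain lo≤ ≤hi (avoid a (a∈ , a⊑R)) P∈

      outside⇒extents≤N : ∀ a {z} → InR R a → InR P z → Outside a → extent o a + extent o z ≤ N
      outside⇒extents≤N a (a∈ , _) (z∈ , z⊑P) out = beside⇒extents≤N o a∈ z∈ (beside out)
        where
        beside : Outside a → Beside o a _
        beside (inj₁ a≤P) = inj₁ (ℚₚ.≤-trans a≤P (proj₁ (⊑⇒within o z⊑P)))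
        beside (inj₂ P≤a) = inj₂ (ℚₚ.≤-trans (proj₁ (proj₂ (⊑⇒within o z⊑P))) P≤a)

      crossed-inside : ∀ z → InR R z → crossedBy o z ≡ true → InR P z
      crossed-inside z zR z-crossed with inside-or-outside z zR
      ... | inj₁ z⊑P = proj₁ zR , z⊑P
      ... | inj₂ out = ⊥-elim (ℕₚ.<⇒≱ (crossed-inseparable m o z w z-crossed w-crossed)
                                      (outside⇒extents≤N z zR (proj₁ wR , w⊑P) out))

      -- every crossed item lies in the piece, so an item outside it lies beside all of them
      inside-or-below-crossed : ∀ a → InR R a →
        InR P a ⊎ (crossedBy o a ≡ false × (∀ z → InR R z → crossedBy o z ≡ true → rank a < rank z))
      inside-or-below-crossed a aR with crossedBy o a in a-crossed
      ... | true  = inj₁ (crossed-inside a aR a-crossed)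
      ... | false with inside-or-outside a aR
      ...   | inj₁ a⊑P = inj₁ (proj₁ aR , a⊑P)
      ...   | inj₂ out = inj₂ (refl , λ z zR z-crossed → beside-crossed⇒rank< m o a z a-crossed z-crossed
                                       (outside⇒extents≤N a aR (crossed-inside z zR z-crossed) out))

      above-neighbour-inside : ∀ {y x} → InR R y → InR R x → rank y < rank x → shape y ≢ shape x → InR P x
      above-neighbour-inside {y} {x} yR xR y<x y≁x with inside-or-below-crossed x xR
      ... | inj₁ xP = xP
      ... | inj₂ (x-uncrossed , below) with one-crossed o y≁x
      ...   | inj₁ x-crossed with () ← trans (sym x-crossed) x-uncrossed
      ...   | inj₂ y-crossed = ⊥-elim (ℕₚ.<-asym y<x (below y yR y-crossed))

      into-piece : ∀ {n x} → Zigzag (InR R) (suc n) x → Zigzag (InR P) n x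
      into-piece (extend (start yR) xR y<x y≁x) = start (above-neighbour-inside yR xR y<x y≁x)
      into-piece (extend zz@(extend _ _ _ _) xR y<x y≁x) =
        extend (into-piece zz) (above-neighbour-inside (top-member zz) xR y<x y≁x) y<x y≁x

  -- each stage confines all but the lowest element of the zigzag to a single piece
  no-zigzag : ∀ {k n o R x b} → Stages I' p k o R → Zigzag (InR R) n x → k ≤ n →
              InR R b → rank x < rank b → ⊥
  no-zigzag (done atMostOne) zz _ bR x<b = ℕₚ.<-irrefl (cong rank (atMostOne _ _ (top-member zz) bR)) x<b
  no-zigzag (stage _ _ _ _) (start _) () _ _
  no-zigzag {o = o} {R} {x} {b} (stage cs chain avoid sub) zz@(extend {y = y} zz' xR y<x y≁x) (s≤s k≤n) bR x<b =
    [ through x xR ℕₚ.≤-refl , through y (top-member zz') (ℕₚ.<⇒≤ y<x) ]′ (one-crossed o y≁x)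
    where
    open InStage chain avoid
    through : ∀ w → InR R w → rank w ≤ rank x → crossedBy o w ≡ true → ⊥
    through w wR w≤x w-crossed with piece-of w wR
    ... | P , P∈ , w⊑P with inside-or-below-crossed P∈ wR w⊑P w-crossed b bR
    ...   | inj₂ (_ , below) = ℕₚ.<-asym (below w wR w-crossed) (ℕₚ.≤-<-trans w≤x x<b)
    ...   | inj₁ bP = no-zigzag (sub P P∈) (into-piece P∈ wR w⊑P w-crossed zz) k≤n bP x<b

lowerPart upperPart : Orient → IBox → ℕ → IBox
lowerPart vert  (ibox x w y h) c = ibox x (c ∸ x) y h
lowerPart horiz (ibox x w y h) c = ibox x w y (c ∸ y)
upperPart vert  (ibox x w y h) c = ibox c (x + w ∸ c) y h
upperPart horiz (ibox x w y h) c = ibox x w c (y + h ∸ c)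

lowEndᴵ highEndᴵ : Orient → IBox → ℕ
lowEndᴵ vert  B = ix B
lowEndᴵ horiz B = iy B
highEndᴵ vert  B = ix B + iw B
highEndᴵ horiz B = iy B + ih B

guillotine-cut : ∀ {m} {I' : SubInstance m} {p} o B c → lowEndᴵ o B < c → c < highEndᴵ o B →
                 (∀ a → InRegion I' p ⟦ B ⟧ a → Avoids o (toℚ c) (boxOf p a)) →
                 Guillotine I' p ⟦ lowerPart o B c ⟧ → Guillotine I' p ⟦ upperPart o B c ⟧ →
                 Guillotine I' p ⟦ B ⟧
guillotine-cut {I' = I'} {p} vert (ibox x w y h) c x<c c<x+w avoid lower upper =
  split vert (toℚ c) (toℚ-mono-< x<c) (subst (toℚ c <ℚ_) (toℚ-+ x w) (toℚ-mono-< c<x+w)) avoid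
    (subst (λ z → Guillotine I' p (box (toℚ x) z (toℚ y) (toℚ h))) (sym (toℚ-∸ (ℕₚ.<⇒≤ x<c))) lower)
    (subst (λ z → Guillotine I' p (box (toℚ c) z (toℚ y) (toℚ h)))
       (sym (trans (cong (_-ℚ toℚ c) (sym (toℚ-+ x w))) (toℚ-∸ (ℕₚ.<⇒≤ c<x+w)))) upper)
guillotine-cut {I' = I'} {p} horiz (ibox x w y h) c y<c c<y+h avoid lower upper =
  split horiz (toℚ c) (toℚ-mono-< y<c) (subst (toℚ c <ℚ_) (toℚ-+ y h) (toℚ-mono-< c<y+h)) avoid
    (subst (λ z → Guillotine I' p (box (toℚ x) (toℚ w) (toℚ y) z)) (sym (toℚ-∸ (ℕₚ.<⇒≤ y<c))) lower)
    (subst (λ z → Guillotine I' p (box (toℚ x) (toℚ w) (toℚ c) z))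
       (sym (trans (cong (_-ℚ toℚ c) (sym (toℚ-+ y h))) (toℚ-∸ (ℕₚ.<⇒≤ c<y+h)))) upper)

avoids-ℕ : ∀ o c B → (highEndᴵ o B ≤ c) ⊎ (c ≤ lowEndᴵ o B) → Avoids o (toℚ c) ⟦ B ⟧
avoids-ℕ vert  c (ibox x w y h) (inj₁ x+w≤c) = inj₁ (toℚ-+-≤ {x} {w} x+w≤c)
avoids-ℕ vert  c (ibox x w y h) (inj₂ c≤x)   = inj₂ (toℚ-mono-≤ c≤x)
avoids-ℕ horiz c (ibox x w y h) (inj₁ y+h≤c) = inj₁ (toℚ-+-≤ {y} {h} y+h≤c)
avoids-ℕ horiz c (ibox x w y h) (inj₂ c≤y)   = inj₂ (toℚ-mono-≤ c≤y)

module Spiral (m : ℕ) where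
  open Sizes m

  slotY : Item m → ℕ
  slotY (H i) = N ∸ mersenne (suc (toℕ i))
  slotY (V i) = 0

  spiral : Placement m
  spiral a = toℚ (mersenne (layer a)) , toℚ (slotY a)

  slot : Item m → IBox
  slot a = ibox (mersenne (layer a)) (widthℕ a) (slotY a) (heightℕ a)

  -- the part of the knapsack left free by the items of rank below r
  region : ℕ → IBox
  region r = ibox (mersenne ⌊ r /2⌋) (N ∸ mersenne ⌊ r /2⌋) 0 (N ∸ mersenne ⌈ r /2⌉)

  region-H : ∀ n → region (double n) ≡ ibox (mersenne n) (N ∸ mersenne n) 0 (N ∸ mersenne n)
  region-H n rewrite ⌊double/2⌋ n | ⌈double/2⌉ n = refl

  region-V : ∀ n → region (suc (double n)) ≡ ibox (mersenne n) (N ∸ mersenne n) 0 (N ∸ mersenne (suc n))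
  region-V n rewrite ⌈double/2⌉ n | ⌊double/2⌋ n = refl

  ⌊/2⌋≤1+m : ∀ {r} → r ≤ double m → ⌊ r /2⌋ ≤ suc m
  ⌊/2⌋≤1+m r≤ = ℕₚ.≤-trans (ℕₚ.⌊n/2⌋-mono r≤) (ℕₚ.≤-trans (ℕₚ.≤-reflexive (⌊double/2⌋ m)) (ℕₚ.n≤1+n m))

  N-split : ∀ {n} → n < m → N ∸ mersenne n ≡ (N ∸ mersenne (suc n)) + 2 ^ n
  N-split {n} n<m = sym (begin
    (N ∸ mersenne (suc n)) + 2 ^ n             ≡⟨ cong (λ z → (N ∸ z) + 2 ^ n) (mersenne-suc n) ⟩
    (N ∸ (mersenne n + 2 ^ n)) + 2 ^ n         ≡⟨ cong (_+ 2 ^ n) (sym (ℕₚ.∸-+-assoc N (mersenne n) (2 ^ n))) ⟩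
    (N ∸ mersenne n ∸ 2 ^ n) + 2 ^ n           ≡⟨ ℕₚ.m∸n+n≡m 2^n≤ ⟩
    N ∸ mersenne n                             ∎)
    where
    open ≡-Reasoning
    2^n≤ : 2 ^ n ≤ N ∸ mersenne n
    2^n≤ = ℕₚ.≤-trans (ℕₚ.≤-reflexive (sym (ℕₚ.m+n∸m≡n (mersenne n) (2 ^ n))))
             (ℕₚ.∸-monoˡ-≤ (mersenne n) (subst (_≤ N) (mersenne-suc n) (mersenne≤N (s≤s (ℕₚ.<⇒≤ n<m)))))

  slot-⊑-region : ∀ a → slot a ⊑ᴵ region (rank a)
  slot-⊑-region (H i) = subst (slot (H i) ⊑ᴵ_) (sym (region-H (toℕ i)))
    (ℕₚ.≤-refl , ℕₚ.≤-refl , z≤n , ℕₚ.≤-reflexive (sym (N-split (Finₚ.toℕ<n i))))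
  slot-⊑-region (V i) = subst (slot (V i) ⊑ᴵ_) (sym (region-V (toℕ i)))
    (ℕₚ.≤-refl ,
     ℕₚ.+-monoʳ-≤ (mersenne (toℕ i)) (subst (2 ^ toℕ i ≤_) (sym (N-split (Finₚ.toℕ<n i))) (ℕₚ.m≤n+m _ _)) ,
     ℕₚ.≤-refl , ℕₚ.≤-refl)

  region-antitone : ∀ {r r'} → r ≤ r' → r' ≤ double m → region r' ⊑ᴵ region r
  region-antitone {r} {r'} r≤r' r'≤ =
    mersenne-mono (ℕₚ.⌊n/2⌋-mono r≤r') ,
    ℕₚ.≤-reflexive (trans (ℕₚ.m+[n∸m]≡n (mersenne≤N (⌊/2⌋≤1+m r'≤)))
                          (sym (ℕₚ.m+[n∸m]≡n (mersenne≤N (⌊/2⌋≤1+m (ℕₚ.≤-trans r≤r' r'≤)))))) ,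
    ℕₚ.≤-refl ,
    ℕₚ.∸-monoʳ-≤ N (mersenne-mono (ℕₚ.⌈n/2⌉-mono r≤r'))

  region-⊑-region : ∀ {r} b → r ≤ rank b → region (rank b) ⊑ᴵ region r
  region-⊑-region b r≤ = region-antitone r≤ (ℕₚ.<⇒≤ (rank<double b))

  Clear : Item m → IBox → Set
  Clear a S = Beyond (shape a) S (slot a)

  clear-next-region : ∀ a → Clear a (region (suc (rank a)))
  clear-next-region (H i) rewrite ⌊double/2⌋ (toℕ i) = ℕₚ.≤-refl
  clear-next-region (V i) rewrite ⌊double/2⌋ (toℕ i) = ℕₚ.≤-reflexive (sym (mersenne-suc (toℕ i)))

  clear-of-later : ∀ a b → rank a < rank b → Clear a (slot b)
  clear-of-later a b a<b =
    beyond-⊑ (shape a) (⊑ᴵ-trans (slot-⊑-region b) (region-⊑-region b a<b))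
      (clear-next-region a)

  slot-width>0 : ∀ a → 0 < widthℕ a
  slot-width>0 (H i) = ℕₚ.m<n⇒0<n∸m (mersenne<N (ℕₚ.<⇒≤ (Finₚ.toℕ<n i)))
  slot-width>0 (V i) = ℕₚ.m^n>0 2 (toℕ i)

  slot-height>0 : ∀ a → 0 < heightℕ a
  slot-height>0 (H i) = ℕₚ.m^n>0 2 (toℕ i)
  slot-height>0 (V i) = ℕₚ.m<n⇒0<n∸m (mersenne<N (Finₚ.toℕ<n i))

  clear-not-inside : ∀ a {S} → Clear a S → slot a ⊑ᴵ S → ⊥
  clear-not-inside a = beyond-not-inside (shape a) (slot-width>0 a) (slot-height>0 a)

  region-⊒-slot⇒≤rank : ∀ b {r} → r ≤ double m → slot b ⊑ᴵ region r → r ≤ rank b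
  region-⊒-slot⇒≤rank b r≤ b⊑r = ℕₚ.≮⇒≥ λ b<r →
    clear-not-inside b (clear-next-region b) (⊑ᴵ-trans b⊑r (region-antitone b<r r≤))

  slots-disjoint : ∀ a b → a ≢ b → Disjointᴵ (slot a) (slot b)
  slots-disjoint a b a≢b with ℕₚ.<-cmp (rank a) (rank b)
  ... | tri< a<b _ _ = beyond⇒disjoint (shape a) (clear-of-later a b a<b)
  ... | tri≈ _ a≡b _ = ⊥-elim (a≢b (rank-injective a≡b))
  ... | tri> _ _ b<a = Disjointᴵ-sym (beyond⇒disjoint (shape b) (clear-of-later b a b<a))

  at-or-after : ∀ a b → slot b ⊑ᴵ region (rank a) → a ≡ b ⊎ rank a < rank b
  at-or-after a b b⊑ with ℕₚ.m≤n⇒m<n∨m≡n (region-⊒-slot⇒≤rank b (ℕₚ.<⇒≤ (rank<double a)) b⊑)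
  ... | inj₁ a<b = inj₂ a<b
  ... | inj₂ a≡b = inj₁ (rank-injective a≡b)

  no-room : ∀ {y h} → 0 < h → y + h ≤ y → ⊥
  no-room h>0 = ℕₚ.<⇒≱ (ℕₚ.m<m+n _ h>0)

  beside-H : ∀ i b → slot b ⊑ᴵ region (rank (H i)) →
             (iy (slot b) + ih (slot b) ≤ slotY (H i)) ⊎ (slotY (H i) ≤ iy (slot b))
  beside-H i b b⊑ = [ (λ { refl → inj₂ ℕₚ.≤-refl }) , (λ i<b → inj₁ (clear-of-later (H i) b i<b)) ]′
                      (at-or-after (H i) b b⊑)

  only-H-above : ∀ i b → slot b ⊑ᴵ region (rank (H i)) → slotY (H i) ≤ iy (slot b) → b ≡ H i
  only-H-above i b b⊑ above = [ sym , (λ i<b → ⊥-elim (no-room (slot-height>0 b)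
                                  (ℕₚ.≤-trans (clear-of-later (H i) b i<b) above))) ]′
                                (at-or-after (H i) b b⊑)

  right-of-V : ∀ i b → rank (V i) < rank b → mersenne (suc (toℕ i)) ≤ ix (slot b)
  right-of-V i b i<b = subst (_≤ ix (slot b)) (sym (mersenne-suc (toℕ i))) (clear-of-later (V i) b i<b)

  beside-V : ∀ i b → slot b ⊑ᴵ region (rank (V i)) →
             (ix (slot b) + iw (slot b) ≤ mersenne (suc (toℕ i))) ⊎ (mersenne (suc (toℕ i)) ≤ ix (slot b))
  beside-V i b b⊑ = [ (λ { refl → inj₁ (ℕₚ.≤-reflexive (sym (mersenne-suc (toℕ i)))) })
                    , (λ i<b → inj₂ (right-of-V i b i<b)) ]′
                      (at-or-after (V i) b b⊑)

  only-V-left : ∀ i b → slot b ⊑ᴵ region (rank (V i)) → ix (slot b) + iw (slot b) ≤ mersenne (suc (toℕ i)) →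
                b ≡ V i
  only-V-left i b b⊑ left = [ sym , (λ i<b → ⊥-elim (no-room (slot-width>0 b)
                                (ℕₚ.≤-trans left (right-of-V i b i<b)))) ]′
                              (at-or-after (V i) b b⊑)

  module SpiralGuillotine (I' : SubInstance m) where

    Guillotineᴵ : IBox → Set
    Guillotineᴵ B = Guillotine I' spiral ⟦ B ⟧

    inRegion⇒⊑ : ∀ {B b} → InRegion I' spiral ⟦ B ⟧ b → slot b ⊑ᴵ B
    inRegion⇒⊑ (_ , b⊑B) = ⟦⟧-cancel-⊑ b⊑B

    step-H : ∀ i → Guillotineᴵ (region (suc (rank (H i)))) → Guillotineᴵ (region (rank (H i)))
    step-H i below = subst Guillotineᴵ (sym (region-H n))
      (guillotine-cut horiz R c 0<c c<top
         (λ b bR → avoids-ℕ horiz c (slot b) (beside-H i b (subst (slot b ⊑ᴵ_) R≡ (inRegion⇒⊑ bR))))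
         (subst Guillotineᴵ (region-V n) below)
         (single λ a b aU bU → trans (is-H aU) (sym (is-H bU))))
      where
      n = toℕ i
      R = ibox (mersenne n) (N ∸ mersenne n) 0 (N ∸ mersenne n)
      R≡ : R ≡ region (rank (H i))
      R≡ = sym (region-H n)
      c = slotY (H i)
      0<c : 0 < c
      0<c = ℕₚ.m<n⇒0<n∸m (mersenne<N (Finₚ.toℕ<n i))
      c<top : c < N ∸ mersenne n
      c<top = subst (c <_) (sym (N-split (Finₚ.toℕ<n i))) (ℕₚ.m<m+n c (ℕₚ.m^n>0 2 n))
      upper⊑R : upperPart horiz R c ⊑ᴵ R
      upper⊑R = ℕₚ.≤-refl , ℕₚ.≤-refl , z≤n , ℕₚ.≤-reflexive (ℕₚ.m+[n∸m]≡n (ℕₚ.<⇒≤ c<top))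
      is-H : ∀ {b} → InRegion I' spiral ⟦ upperPart horiz R c ⟧ b → b ≡ H i
      is-H {b} bU = let b⊑U = inRegion⇒⊑ bU in
        only-H-above i b (subst (slot b ⊑ᴵ_) R≡ (⊑ᴵ-trans b⊑U upper⊑R)) (proj₁ (proj₂ (proj₂ b⊑U)))

    step-V : ∀ i → Guillotineᴵ (region (suc (rank (V i)))) → Guillotineᴵ (region (rank (V i)))
    step-V i right = subst Guillotineᴵ (sym (region-V n))
      (guillotine-cut vert R c left<c c<right
         (λ b bR → avoids-ℕ vert c (slot b) (beside-V i b (subst (slot b ⊑ᴵ_) R≡ (inRegion⇒⊑ bR))))
         (single λ a b aL bL → trans (is-V aL) (sym (is-V bL)))
         (subst Guillotineᴵ upper≡ right))
      where
      n = toℕ i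
      R = ibox (mersenne n) (N ∸ mersenne n) 0 (N ∸ mersenne (suc n))
      R≡ : R ≡ region (rank (V i))
      R≡ = sym (region-V n)
      c = mersenne (suc n)
      left<c : mersenne n < c
      left<c = mersenne<mersenne-suc n
      N≡ : mersenne n + (N ∸ mersenne n) ≡ N
      N≡ = ℕₚ.m+[n∸m]≡n (mersenne≤N (ℕₚ.m≤n⇒m≤1+n (ℕₚ.<⇒≤ (Finₚ.toℕ<n i))))
      c<right : c < mersenne n + (N ∸ mersenne n)
      c<right = subst (c <_) (sym N≡) (mersenne<N (Finₚ.toℕ<n i))
      upper≡ : region (suc (rank (V i))) ≡ upperPart vert R c
      upper≡ = trans (region-H (suc n)) (cong (λ z → ibox c (z ∸ c) 0 (N ∸ c)) (sym N≡))
      lower-end : mersenne n + (c ∸ mersenne n) ≡ c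
      lower-end = ℕₚ.m+[n∸m]≡n (ℕₚ.<⇒≤ left<c)
      lower⊑R : lowerPart vert R c ⊑ᴵ R
      lower⊑R = ℕₚ.≤-refl , ℕₚ.≤-trans (ℕₚ.≤-reflexive lower-end) (ℕₚ.<⇒≤ c<right) , ℕₚ.≤-refl , ℕₚ.≤-refl
      is-V : ∀ {b} → InRegion I' spiral ⟦ lowerPart vert R c ⟧ b → b ≡ V i
      is-V {b} bL = let b⊑L = inRegion⇒⊑ bL in
        only-V-left i b (subst (slot b ⊑ᴵ_) R≡ (⊑ᴵ-trans b⊑L lower⊑R))
          (ℕₚ.≤-trans (proj₁ (proj₂ b⊑L)) (ℕₚ.≤-reflexive lower-end))

    guillotine-from : ∀ d r → d + r ≡ double m → Guillotineᴵ (region r)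
    guillotine-from zero r refl = single λ b _ bR _ →
      ⊥-elim (ℕₚ.<⇒≱ (rank<double b) (region-⊒-slot⇒≤rank b ℕₚ.≤-refl (inRegion⇒⊑ bR)))
    guillotine-from (suc d) r eq with rank-surjective m (subst (r <_) eq (ℕₚ.m<n+m r (s≤s z≤n)))
    ... | H i , refl = step-H i (guillotine-from d (suc (rank (H i))) (trans (ℕₚ.+-suc d _) eq))
    ... | V i , refl = step-V i (guillotine-from d (suc (rank (V i))) (trans (ℕₚ.+-suc d _) eq))

    spiral-guillotine : Guillotine I' spiral (knapsack m)
    spiral-guillotine = guillotine-from (double m) 0 (ℕₚ.+-identityʳ (double m))

module Levels {m : ℕ} (I' : SubInstance m) where

  Member : Item m → Set
  Member a = a ∈' I'

  keepMember : Item m → Maybe (Item m)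
  keepMember a = if I' a then just a else nothing

  present : ℕ → Maybe (Item m)
  present r = itemOfRank m r >>= keepMember

  present⇒member : ∀ r {a} → present r ≡ just a → Member a × rank a ≡ r
  present⇒member r eq with itemOfRank m r in eq₁
  ... | just b with I' b in eq₂
  present⇒member r refl | just b | true = eq₂ , itemOfRank⇒rank r eq₁

  present-rank : ∀ {a} → Member a → present (rank a) ≡ just a
  present-rank {a} a∈ rewrite itemOfRank-rank a | a∈ = refl

  not-present : ∀ {r} → present r ≡ nothing → ∀ {b} → Member b → rank b ≢ r
  not-present eq b∈ refl with () ← trans (sym (present-rank b∈)) eq

  below : ℕ → Maybe (Item m)
  below zero    = nothing
  below (suc r) = present r <∣> below r

  below-nothing : ∀ r → below r ≡ nothing → ∀ {b} → Member b → r ≤ rank b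
  below-nothing zero    _  _ = z≤n
  below-nothing (suc r) eq b∈ with present r in eq₁
  ... | nothing = ℕₚ.≤∧≢⇒< (below-nothing r eq b∈) (λ r≡ → not-present eq₁ b∈ (sym r≡))

  below-just : ∀ r {x} → below r ≡ just x →
               Member x × rank x < r × (∀ {b} → Member b → rank b < r → rank b ≤ rank x)
  below-just (suc r) eq with present r in eq₁
  below-just (suc r) refl | just a =
    let (a∈ , a≡r) = present⇒member r eq₁ in
    a∈ , s≤s (ℕₚ.≤-reflexive a≡r) , λ _ b<1+r → subst (_ ≤_) (sym a≡r) (ℕₚ.≤-pred b<1+r)
  below-just (suc r) eq   | nothing =
    let (x∈ , x<r , maximal) = below-just r eq in
    x∈ , ℕₚ.m≤n⇒m≤1+n x<r ,
    λ b∈ b<1+r → maximal b∈ (ℕₚ.≤∧≢⇒< (ℕₚ.≤-pred b<1+r) (not-present eq₁ b∈))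

  below-rank : ∀ {a} → Member a → below (suc (rank a)) ≡ just a
  below-rank a∈ rewrite present-rank a∈ = refl

  below-some : ∀ {r x} → Member x → rank x < r → Σ (Item m) (λ y → below r ≡ just y)
  below-some {r} x∈ x<r with below r in eq
  ... | just y  = y , refl
  ... | nothing = ⊥-elim (ℕₚ.<⇒≱ x<r (below-nothing r eq x∈))

  shapeChange : Item m → Item m → ℕ
  shapeChange (H _) (H _) = 0
  shapeChange (V _) (V _) = 0
  shapeChange (H _) (V _) = 1
  shapeChange (V _) (H _) = 1

  shapeChange-same : ∀ y a → shape y ≡ shape a → shapeChange y a ≡ 0
  shapeChange-same (H _) (H _) _ = refl
  shapeChange-same (V _) (V _) _ = refl

  shapeChange-differ : ∀ y a → shape y ≢ shape a → shapeChange y a ≡ 1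
  shapeChange-differ (H _) (H _) ne = ⊥-elim (ne refl)
  shapeChange-differ (V _) (V _) ne = ⊥-elim (ne refl)
  shapeChange-differ (H _) (V _) _  = refl
  shapeChange-differ (V _) (H _) _  = refl

  change : Maybe (Item m) → Maybe (Item m) → ℕ
  change _        nothing  = 0
  change nothing  (just _) = 0
  change (just y) (just a) = shapeChange y a

  changes : ℕ → ℕ
  changes zero    = 0
  changes (suc r) = change (below r) (present r) + changes r

  changes-mono : ∀ {r r'} → r ≤ r' → changes r ≤ changes r'
  changes-mono r≤r' = go (ℕₚ.≤⇒≤′ r≤r')
    where
    go : ∀ {r r'} → r ≤′ r' → changes r ≤ changes r'
    go ≤′-refl        = ℕₚ.≤-refl
    go (≤′-step r≤r') = ℕₚ.≤-trans (go r≤r') (ℕₚ.m≤n+m _ _)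

  changes-nothing : ∀ r → below r ≡ nothing → changes r ≡ 0
  changes-nothing zero    _  = refl
  changes-nothing (suc r) eq with present r
  ... | nothing = changes-nothing r eq

  changes-below : ∀ r {x} → below r ≡ just x → changes r ≡ changes (suc (rank x))
  changes-below (suc r) eq with present r in eq₁
  changes-below (suc r) refl | just a  rewrite proj₂ (present⇒member r eq₁) | eq₁ = refl
  changes-below (suc r) eq   | nothing = changes-below r eq

  zigzag-below : ∀ r {x} → below r ≡ just x → Zigzag Member (changes r) x
  zigzag-below (suc r) eq with present r in eq₁
  zigzag-below (suc r) eq   | nothing = zigzag-below r eq
  zigzag-below (suc r) refl | just a with present⇒member r eq₁ | below r in eq₂
  ... | a∈ , _   | nothing rewrite changes-nothing r eq₂ = start a∈
  ... | a∈ , a≡r | just y with shape y ≟ₒ shape a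
  ...   | yes same rewrite shapeChange-same y a same =
    retop (zigzag-below r eq₂) a∈ y<a same
    where y<a = subst (rank y <_) (sym a≡r) (proj₁ (proj₂ (below-just r eq₂)))
  ...   | no differ rewrite shapeChange-differ y a differ =
    extend (zigzag-below r eq₂) a∈ y<a differ
    where y<a = subst (rank y <_) (sym a≡r) (proj₁ (proj₂ (below-just r eq₂)))

  changes-grow : ∀ r {x y} → Member x → rank x < r → below r ≡ just y → shape y ≢ shape x →
                 changes (suc (rank x)) < changes r
  changes-grow (suc r) {x} x∈ x<1+r eq differ with ℕₚ.m≤n⇒m<n∨m≡n (ℕₚ.≤-pred x<1+r)
  ... | inj₂ refl rewrite present-rank x∈ with refl ← eq = ⊥-elim (differ refl)
  ... | inj₁ x<r with present r in eq₁
  ...   | nothing = changes-grow r x∈ x<r eq differ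
  changes-grow (suc r) {x} x∈ x<1+r refl differ | inj₁ x<r | just a
    with below-some {r} x∈ x<r
  ... | y' , eq₂ rewrite eq₂ with shape y' ≟ₒ shape x
  ...   | yes same rewrite shapeChange-differ y' a (λ y'≡a → differ (trans (sym y'≡a) same)) =
    s≤s (changes-mono x<r)
  ...   | no y'≁x = ℕₚ.<-≤-trans (changes-grow r x∈ x<r eq₂ y'≁x) (ℕₚ.m≤n+m _ _)

  IsLast : Item m → Set
  IsLast a = ∀ {b} → Member b → rank b ≤ rank a

  lastRank : ℕ
  lastRank = Maybe.maybe rank 0 (below (double m))

  -- capping at lastRank keeps the last member on the level of its predecessor
  level : Item m → ℕ
  level a = changes (suc (rank a) ⊓ lastRank)

  level-mono : ∀ a b → rank a ≤ rank b → level a ≤ level b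
  level-mono a b a≤b = changes-mono (ℕₚ.⊓-monoˡ-≤ lastRank (s≤s a≤b))

  lastRank-bounds : ∀ {a} → Member a → rank a ≤ lastRank × Σ (Item m) (λ f → Member f × rank f ≡ lastRank)
  lastRank-bounds {a} a∈ with below (double m) in eq
  ... | just f  = let (f∈ , _ , maximal) = below-just (double m) eq in
                  maximal a∈ (rank<double a) , f , f∈ , refl
  ... | nothing = ⊥-elim (ℕₚ.<⇒≱ (rank<double a) (below-nothing (double m) eq a∈))

  level-before : ∀ {a b} → Member a → Member b → rank a < rank b → level a ≡ changes (suc (rank a))
  level-before a∈ b∈ a<b =
    cong changes (ℕₚ.m≤n⇒m⊓n≡m (ℕₚ.<-≤-trans a<b (proj₁ (lastRank-bounds b∈))))

  level-last : ∀ {a} → Member a → IsLast a → level a ≡ changes (rank a)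
  level-last {a} a∈ last with lastRank-bounds a∈
  ... | a≤ , f , f∈ , f≡ =
    cong changes (trans (ℕₚ.m≥n⇒m⊓n≡n (ℕₚ.m≤n⇒m≤1+n ≤a)) (ℕₚ.≤-antisym ≤a a≤))
    where ≤a = subst (_≤ rank a) f≡ (last f∈)

  last-or-before : ∀ {a} → Member a → IsLast a ⊎ Σ (Item m) (λ b → Member b × rank a < rank b)
  last-or-before a∈ with lastRank-bounds a∈
  ... | a≤ , f , f∈ , f≡ with ℕₚ.m≤n⇒m<n∨m≡n a≤
  ...   | inj₁ a<last = inj₂ (f , f∈ , subst (_ <_) (sym f≡) a<last)
  ...   | inj₂ a≡last = inj₁ λ b∈ → subst (_ ≤_) (sym a≡last) (proj₁ (lastRank-bounds b∈))

  NoZigzag : ℕ → Set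
  NoZigzag k = ∀ {n x b} → Zigzag Member n x → k ≤ n → Member b → rank x < rank b → ⊥

  module _ {k} (noZigzag : NoZigzag (suc k)) where

    changes-before-bound : ∀ {x b} → Member x → Member b → rank x < rank b → changes (suc (rank x)) ≤ k
    changes-before-bound {x} x∈ b∈ x<b =
      ℕₚ.≤-pred (ℕₚ.≰⇒> λ k<c → noZigzag (zigzag-below (suc (rank x)) (below-rank x∈)) k<c b∈ x<b)

    level-bound : ∀ {a} → Member a → level a ≤ k
    level-bound {a} a∈ with last-or-before a∈
    ... | inj₂ (b , b∈ , a<b) = subst (_≤ k) (sym (level-before a∈ b∈ a<b)) (changes-before-bound a∈ b∈ a<b)
    ... | inj₁ last rewrite level-last a∈ last with below (rank a) in eq
    ...   | nothing = subst (_≤ k) (sym (changes-nothing (rank a) eq)) z≤n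
    ...   | just p  = let (p∈ , p<a , _) = below-just (rank a) eq in
                      subst (_≤ k) (sym (changes-below (rank a) eq)) (changes-before-bound p∈ a∈ p<a)

  module _ {P : Item m → Set} (P? : Decidable P) where

    keepIf : Item m → Maybe (Item m)
    keepIf a = if does (P? a) then just a else nothing

    firstBelow : ℕ → Maybe (Item m)
    firstBelow zero    = nothing
    firstBelow (suc r) = firstBelow r <∣> (present r >>= keepIf)

    firstBelow-nothing : ∀ r → firstBelow r ≡ nothing → ∀ {b} → Member b → rank b < r → ¬ P b
    firstBelow-nothing (suc r) eq {b} b∈ b<1+r Pb with firstBelow r in eq₁
    ... | nothing with ℕₚ.m≤n⇒m<n∨m≡n (ℕₚ.≤-pred b<1+r)
    ...   | inj₁ b<r = firstBelow-nothing r eq₁ b∈ b<r Pb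
    ...   | inj₂ refl rewrite present-rank b∈ with P? b
    ...     | no ¬Pb = ¬Pb Pb

    firstBelow-just : ∀ r {x} → firstBelow r ≡ just x →
                      Member x × P x × (∀ {b} → Member b → P b → rank x ≤ rank b)
    firstBelow-just (suc r) eq with firstBelow r in eq₁
    firstBelow-just (suc r) refl | just x  = firstBelow-just r eq₁
    firstBelow-just (suc r) eq   | nothing with present r in eq₂
    ... | just a with P? a
    firstBelow-just (suc r) refl | nothing | just a | yes Pa =
      let (a∈ , a≡r) = present⇒member r eq₂ in
      a∈ , Pa , λ b∈ Pb → subst (_≤ _) (sym a≡r) (ℕₚ.≮⇒≥ λ b<r → firstBelow-nothing r eq₁ b∈ b<r Pb)

  leader : ℕ → Maybe (Item m)
  leader t = firstBelow (λ a → t ≤? level a) (double m)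

  leader-nothing : ∀ {t} → leader t ≡ nothing → ∀ {b} → Member b → level b < t
  leader-nothing eq {b} b∈ = ℕₚ.≰⇒> (firstBelow-nothing _ (double m) eq b∈ (rank<double b))

  leader-just : ∀ {t x} → leader t ≡ just x →
                Member x × t ≤ level x × (∀ {b} → Member b → t ≤ level b → rank x ≤ rank b)
  leader-just = firstBelow-just _ (double m)

  leader-exists : ∀ {a} → Member a → Σ (Item m) (λ x → leader (level a) ≡ just x)
  leader-exists {a} a∈ with leader (level a) in eq
  ... | just x  = x , refl
  ... | nothing = ⊥-elim (ℕₚ.<-irrefl refl (leader-nothing eq a∈))

  leader-on-level : ∀ {a x} → Member a → leader (level a) ≡ just x →
                    Member x × rank x ≤ rank a × level x ≡ level a
  leader-on-level {a} {x} a∈ eq = let (x∈ , t≤x , least) = leader-just eq; x≤a = least a∈ ℕₚ.≤-refl in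
    x∈ , x≤a , ℕₚ.≤-antisym (level-mono x a x≤a) t≤x

  leader-after : ∀ {a y} → Member a → leader (suc (level a)) ≡ just y → rank a < rank y
  leader-after {a} {y} a∈ eq = ℕₚ.≰⇒> λ y≤a → ℕₚ.<⇒≱ (proj₁ (proj₂ (leader-just eq))) (level-mono y a y≤a)

  leader-mono : ∀ {t t' x y} → t ≤ t' → leader t ≡ just x → leader t' ≡ just y → rank x ≤ rank y
  leader-mono t≤t' eqx eqy = let (y∈ , t'≤y , _) = leader-just eqy in
    proj₂ (proj₂ (leader-just eqx)) y∈ (ℕₚ.≤-trans t≤t' t'≤y)

  leader-between : ∀ {t t' x'} → t ≤ t' → leader t' ≡ just x' → Σ (Item m) (λ y → leader t ≡ just y)
  leader-between {t} t≤t' eq' with leader t in eq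
  ... | just y  = y , refl
  ... | nothing = let (x'∈ , t'≤x' , _) = leader-just eq' in
                  ⊥-elim (ℕₚ.<⇒≱ (leader-nothing eq x'∈) (ℕₚ.≤-trans t≤t' t'≤x'))

  other-shape⇒last : ∀ {a x} → Member a → leader (level a) ≡ just x → shape x ≢ shape a → IsLast a
  other-shape⇒last {a} {x} a∈ eq x≁a with last-or-before a∈
  ... | inj₁ last = last
  ... | inj₂ (b , b∈ , a<b) with leader-on-level a∈ eq
  ...   | x∈ , x≤a , x≡a with ℕₚ.m≤n⇒m<n∨m≡n x≤a
  ...     | inj₂ x≡a = ⊥-elim (x≁a (cong shape (rank-injective x≡a)))
  ...     | inj₁ x<a = ⊥-elim (ℕₚ.<-irrefl x≡a'
    (changes-grow (suc (rank a)) x∈ (ℕₚ.m<n⇒m<1+n x<a) (below-rank a∈) (≢-sym x≁a)))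
    where
    x≡a' : changes (suc (rank x)) ≡ changes (suc (rank a))
    x≡a' = trans (sym (level-before x∈ a∈ x<a)) (trans x≡a (level-before a∈ b∈ a<b))

  last⇒no-next-leader : ∀ {a} → Member a → IsLast a → leader (suc (level a)) ≡ nothing
  last⇒no-next-leader {a} a∈ last with leader (suc (level a)) in eq
  ... | nothing = refl
  ... | just y  = ⊥-elim (ℕₚ.<⇒≱ (leader-after a∈ eq) (last (proj₁ (leader-just eq))))

module Containers (m : ℕ) (I' : SubInstance m) where
  open Sizes m
  open Spiral m
  open Levels I'

  corner : IBox
  corner = ibox N 0 0 0

  corner-⊑-region : ∀ {r} → r ≤ double m → corner ⊑ᴵ region r
  corner-⊑-region r≤ = let A≤N = mersenne≤N (⌊/2⌋≤1+m r≤) in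
    A≤N , ℕₚ.≤-reflexive (trans (ℕₚ.+-identityʳ N) (sym (ℕₚ.m+[n∸m]≡n A≤N))) , z≤n , z≤n

  corner-disjoint : ∀ {T} → T ⊑ᴵ region 0 → Disjointᴵ corner T
  corner-disjoint (_ , T≤N , _ , _) = inj₂ (inj₁ T≤N)

  slot-⊑-knapsack : ∀ a → slot a ⊑ᴵ region 0
  slot-⊑-knapsack a = ⊑ᴵ-trans (slot-⊑-region a) (region-⊑-region a z≤n)

  beyond-corner : ∀ o a → Beyond o corner (slot a)
  beyond-corner horiz a = z≤n
  beyond-corner vert  a = proj₁ (proj₂ (slot-⊑-knapsack a))

  rest : Maybe (Item m) → IBox
  rest nothing  = corner
  rest (just y) = region (rank y)

  corner-⊑-rest : ∀ l → corner ⊑ᴵ rest l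
  corner-⊑-rest nothing  = ⊑ᴵ-refl
  corner-⊑-rest (just y) = corner-⊑-region (ℕₚ.<⇒≤ (rank<double y))

  -- the leader's region cut along the region of the next leader; a level without
  -- members gets the empty box at the corner (N , 0)
  containerOf : Maybe (Item m) → Maybe (Item m) → IBox
  containerOf nothing  _    = corner
  containerOf (just x) next = carve (shape x) (region (rank x)) (rest next)

  container : ℕ → IBox
  container t = containerOf (leader t) (leader (suc t))

  rest-⊑-region : ∀ {t x} → leader t ≡ just x → rest (leader (suc t)) ⊑ᴵ region (rank x)
  rest-⊑-region {t} {x} eq with leader (suc t) in eq'
  ... | nothing = corner-⊑-region (ℕₚ.<⇒≤ (rank<double x))
  ... | just y  = region-⊑-region y (leader-mono (ℕₚ.n≤1+n t) eq eq')

  container-⊑-knapsack : ∀ t → container t ⊑ᴵ region 0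
  container-⊑-knapsack t = from-leader (leader t) refl
    where
    from-leader : ∀ l → leader t ≡ l → containerOf l (leader (suc t)) ⊑ᴵ region 0
    from-leader nothing  _  = corner-⊑-region z≤n
    from-leader (just x) eq = ⊑ᴵ-trans (carve-⊑ (shape x) (rest-⊑-region eq)) (region-⊑-region x z≤n)

  container-⊑-rest : ∀ {t t'} → t < t' → container t' ⊑ᴵ rest (leader (suc t))
  container-⊑-rest {t} {t'} t<t' = from-leader (leader t') refl
    where
    from-leader : ∀ l → leader t' ≡ l → containerOf l (leader (suc t')) ⊑ᴵ rest (leader (suc t))
    from-leader nothing   _   = corner-⊑-rest (leader (suc t))
    from-leader (just x') eq' with leader-between t<t' eq'
    ... | y , eqy = subst (λ l → _ ⊑ᴵ rest l) (sym eqy)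
      (⊑ᴵ-trans (carve-⊑ (shape x') (rest-⊑-region eq')) (region-⊑-region x' (leader-mono t<t' eqy eq')))

  containers-disjoint : ∀ {t t'} → t < t' → Disjointᴵ (container t) (container t')
  containers-disjoint {t} {t'} t<t' = from-leader (leader t) refl
    where
    from-leader : ∀ l → leader t ≡ l → Disjointᴵ (containerOf l (leader (suc t))) (container t')
    from-leader nothing  _  = corner-disjoint (container-⊑-knapsack t')
    from-leader (just x) eq = carve-disjoint (shape x) (rest-⊑-region eq) (container-⊑-rest t<t')

  distinct-containers-disjoint : ∀ {t t'} → t ≢ t' → Disjointᴵ (container t) (container t')
  distinct-containers-disjoint {t} {t'} t≢t' with ℕₚ.<-cmp t t'
  ... | tri< t<t' _ _ = containers-disjoint t<t'
  ... | tri≈ _ t≡t' _ = ⊥-elim (t≢t' t≡t')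
  ... | tri> _ _ t'<t = Disjointᴵ-sym (containers-disjoint t'<t)

  slot-beyond-rest : ∀ {a x} → Member a → leader (level a) ≡ just x →
                     Beyond (shape x) (rest (leader (suc (level a)))) (slot a)
  slot-beyond-rest {a} {x} a∈ eq with shape x ≟ₒ shape a
  ... | no x≁a rewrite last⇒no-next-leader a∈ (other-shape⇒last a∈ eq x≁a) = beyond-corner (shape x) a
  ... | yes x≈a rewrite x≈a with leader (suc (level a)) in eq'
  ...   | nothing = beyond-corner (shape a) a
  ...   | just y  = beyond-⊑ (shape a) (region-⊑-region y (leader-after a∈ eq')) (clear-next-region a)

  slot-⊑-container : ∀ {a} → Member a → slot a ⊑ᴵ container (level a)
  slot-⊑-container {a} a∈ with leader-exists a∈
  ... | x , eq = subst (λ l → slot a ⊑ᴵ containerOf l (leader (suc (level a)))) (sym eq)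
    (⊑-carve (shape x)
      (⊑ᴵ-trans (slot-⊑-region a) (region-⊑-region a (proj₁ (proj₂ (leader-on-level a∈ eq)))))
      (slot-beyond-rest a∈ eq))

  beyond-later-on-level : ∀ {t x} a b → leader t ≡ just x → Member a → level a ≡ t →
                          Member b → rank a < rank b → Beyond (shape x) (slot b) (slot a)
  beyond-later-on-level {x = x} a b eq a∈ refl b∈ a<b with shape x ≟ₒ shape a
  ... | yes x≈a rewrite x≈a = clear-of-later a b a<b
  ... | no x≁a  = ⊥-elim (ℕₚ.<⇒≱ a<b (other-shape⇒last a∈ eq x≁a b∈))

  above⇒YDisjoint : ∀ a b → Beyond horiz (slot a) (slot b) → YDisjoint (boxOf spiral a) (boxOf spiral b)
  above⇒YDisjoint a b above = inj₁ (toℚ-+-≤ {slotY a} {heightℕ a} above)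

  left⇒XDisjoint : ∀ a b → Beyond vert (slot b) (slot a) → XDisjoint (boxOf spiral a) (boxOf spiral b)
  left⇒XDisjoint a b left = inj₁ (toℚ-+-≤ {mersenne (layer a)} {widthℕ a} left)

  kindOf : Maybe (Item m) → Kind
  kindOf nothing      = large
  kindOf (just (H _)) = horizontal
  kindOf (just (V _)) = vertical

  rank-order : ∀ {a b : Item m} → a ≢ b → rank a < rank b ⊎ rank b < rank a
  rank-order {a} {b} a≢b with ℕₚ.<-cmp (rank a) (rank b)
  ... | tri< a<b _ _ = inj₁ a<b
  ... | tri≈ _ a≡b _ = ⊥-elim (a≢b (rank-injective a≡b))
  ... | tri> _ _ b<a = inj₂ b<a

  kindOf-ok : ∀ ε t (In : Item m → Set) → (∀ {a} → In a → Member a × level a ≡ t) →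
              ∀ l → leader t ≡ l → ∀ C → KindOK ε I' spiral In (kindOf l) C
  kindOf-ok ε t In on-t nothing eq C a b ina _ =
    let (a∈ , a-on-t) = on-t ina in ⊥-elim (ℕₚ.<-irrefl a-on-t (leader-nothing eq a∈))
  kindOf-ok ε t In on-t (just (H j)) eq C a b ina inb a≢b =
    let (a∈ , a-on-t) = on-t ina ; (b∈ , b-on-t) = on-t inb in
    [ (λ a<b → swap (above⇒YDisjoint b a (beyond-later-on-level a b eq a∈ a-on-t b∈ a<b)))
    , (λ b<a → above⇒YDisjoint a b (beyond-later-on-level b a eq b∈ b-on-t a∈ b<a)) ]′ (rank-order a≢b)
  kindOf-ok ε t In on-t (just (V j)) eq C a b ina inb a≢b =
    let (a∈ , a-on-t) = on-t ina ; (b∈ , b-on-t) = on-t inb in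
    [ (λ a<b → left⇒XDisjoint a b (beyond-later-on-level a b eq a∈ a-on-t b∈ a<b))
    , (λ b<a → swap (left⇒XDisjoint b a (beyond-later-on-level b a eq b∈ b-on-t a∈ b<a))) ]′ (rank-order a≢b)

  spiral-packing : IsPacking I' spiral
  spiral-packing = (λ a _ → ⟦⟧-mono-⊑ (slot-⊑-knapsack a)) ,
                   (λ a b _ _ a≢b → ⟦⟧-disjoint (slots-disjoint a b a≢b))

  spiral-containers : ∀ ε k → (∀ {a} → Member a → level a < k) → ContainerPacking ε I' spiral k
  spiral-containers ε k bound = record
    { container  = λ i → ⟦ container (toℕ i) ⟧
    ; kind       = λ i → kindOf (leader (toℕ i))
    ; assign     = λ a a∈ → Fin.fromℕ< (bound a∈)
    ; packing    = spiral-packing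
    ; inKnapsack = λ i → ⟦⟧-mono-⊑ (container-⊑-knapsack (toℕ i))
    ; disjoint   = λ i j i≢j → ⟦⟧-disjoint (distinct-containers-disjoint (i≢j ∘ Finₚ.toℕ-injective))
    ; inside     = λ a a∈ → ⟦⟧-mono-⊑ (subst (λ t → slot a ⊑ᴵ container t)
                                               (sym (Finₚ.toℕ-fromℕ< (bound a∈))) (slot-⊑-container a∈))
    ; kindOK     = λ i → kindOf-ok ε (toℕ i) _
                           (λ (a∈ , assigned) → a∈ , trans (sym (Finₚ.toℕ-fromℕ< (bound a∈))) (cong toℕ assigned))
                           (leader (toℕ i)) refl ⟦ container (toℕ i) ⟧
    }

mainTheorem14 : (ε : ℚ) → 0ℚ <ℚ ε →
    (m k : ℕ) → 1 ≤ k → (I' : SubInstance m) →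
    (∀ a → a ∈' I' → Long a) →
    (p : Placement m) → IsKStagePacking k I' p →
    Σ ℕ (λ c → Σ (Placement m) (λ q →
      (c ≤ k) × ContainerPacking ε I' q c × Guillotine I' q (knapsack m)))
mainTheorem14 ε _ m (suc k) (s≤s z≤n) I' _ p ((inKnapsack , _) , _ , stages) =
  suc k , spiral , ℕₚ.≤-refl , spiral-containers ε (suc k) (s≤s ∘ level-bound no-long-zigzag) , spiral-guillotine
  where
  open Spiral m
  open SpiralGuillotine I'
  open Levels I'
  open Containers m I'
  open StageLowerBound I' p inKnapsack
  no-long-zigzag : NoZigzag (suc k)
  no-long-zigzag zz k<n b∈ x<b =
    no-zigzag stages (zigzag-map (λ a∈ → a∈ , inKnapsack _ a∈) zz) k<n (b∈ , inKnapsack _ b∈) x<b
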